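{- Let $G$ be a finite simple undirected connected AT-free graph of girth at least $5$ on $n$ vertices, let $x,y$ be a dominating pair with $\mathrm{dist}(x,y)=\mathrm{diam}(G)$, and let $P$ be a shortest $x$-$y$ path with vertices $u_1=x,\dots,u_d=y$ in order. For $1\le i\le d$ let $S_i=\{v\notin V(P): u_i\in N_G(v)\}$, with $S_i=\emptyset$ for $i\notin\{1,\dots,d\}$, and let $S$ be the set of vertices $v\notin V(P)$ having a neighbour outside $V(P)$. Enumerate $S_i\setminus S$ as $v_{i,1},v_{i,2},\dots$. Define $g_1$: $g_1(u_i)=[i,i+1]$; $g_1(v_{i,j})=[i+\frac{2j-1}{2n},i+\frac{2j}{2n}]$; for $v\in S_i\cap S$: $[i-\frac12,i+\frac32]$ if $N_G(v)\cap S_{i-2}\ne\emptyset\ne N_G(v)\cap S_{i+2}$, $[i+1,i+\frac32]$ if $N_G(v)\cap S_{i-2}=\emptyset\ne N_G(v)\cap S_{i+2}$, $[i-\frac12,i]$ if $N_G(v)\cap S_{i-2}\ne\emptyset=N_G(v)\cap S_{i+2}$. Define $g_2$: $g_2(u_i)=[1,2]$ ($i$ odd), $[2,3]$ ($i$ even); for $v\in S_i\setminus S$: $[\frac54,\frac74]$ ($i$ odd), $[\frac94,\frac{11}4]$ ($i$ even); for $v\in S_i\cap S$: $[0,1]$ ($i$ odd), $[3,4]$ ($i$ even). For $k=1,2$ let $I_k$ be the graph on $V(G)$ in which distinct $u,v$ are adjacent iff $g_k(u)\cap g_k(v)\ne\emptyset$. Then for any distinct $u,v$ with $(u,v)\notin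 E(G)$, either $(u,v)\notin E(I_1)$ or $(u,v)\notin E(I_2)$.
   Context: $G$ is AT-free if it has no asteroidal triple (independent set of three vertices such that between each pair there is a path avoiding the neighbourhood of the third). A pair $x,y$ is a dominating pair if the vertex set of every $x$-$y$ path is a dominating set. $N_G(v)$ is the neighbourhood of $v$. (In this setting each vertex outside $V(P)$ lies in exactly one $S_i$.) -}

module Defs where

open import Data.Nat as ℕ using (ℕ; zero; suc; _∸_; _≤_; _%_; NonZero)
open import Data.Nat.Properties using (m*n≢0)
open import Data.Integer using (+_)
open import Data.Rational as ℚ using (ℚ; ½; _/_)
open import Data.Fin using (Fin; toℕ)
open import Data.Bool using (Bool; T)
open import Data.Maybe using (just)
open import Data.List using (List; []; _∷_; _++_; length; lookup; head; last)
open import Data.List.Membership.Propositional using (_∈_; _∉_)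
open import Data.List.Relation.Unary.All using (All)
open import Data.List.Relation.Unary.Linked using (Linked)
open import Data.List.Relation.Unary.Unique.Propositional using (Unique)
open import Data.Product using (Σ; ∃; ∃-syntax; _×_; _,_)
open import Data.Sum using (_⊎_)
open import Data.Empty using (⊥)
open import Relation.Nullary using (¬_)
open import Relation.Binary.PropositionalEquality using (_≡_; _≢_)
open import Function.Bundles using (_⇔_)

record Graph (n : ℕ) : Set where
  field
    adj    : Fin n → Fin n → Bool
    sym    : ∀ u v → adj u v ≡ adj v u
    irrefl : ∀ v → adj v v ≡ Data.Bool.false

module _ {n : ℕ} (G : Graph n) where
  open Graph G

  V : Set
  V = Fin n

  Adj : V → V → Set
  Adj u v = T (adj u v)

  IsWalk : V → V → List V → Set
  IsWalk a b W = Linked Adj W × head W ≡ just a × last W ≡ just b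

  IsPath : V → V → List V → Set
  IsPath a b W = IsWalk a b W × Unique W

  Connected : Set
  Connected = ∀ a b → ∃[ W ] IsPath a b W

  IsDist : V → V → ℕ → Set
  IsDist a b k = (∃[ W ] (IsPath a b W × length W ≡ suc k))
               × (∀ W → IsWalk a b W → suc k ≤ length W)

  IsDiam : ℕ → Set
  IsDiam k = (∀ a b → ∃[ k' ] (IsDist a b k' × k' ≤ k))
           × (∃[ a ] ∃[ b ] IsDist a b k)

  IsShortestPath : V → V → List V → Set
  IsShortestPath a b P = IsPath a b P × (∀ W → IsPath a b W → length P ≤ length W)

  IsCycle : List V → Set
  IsCycle [] = ⊥
  IsCycle (v ∷ vs) = 2 ≤ length vs × Unique (v ∷ vs) × Linked Adj ((v ∷ vs) ++ (v ∷ []))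

  Girth≥5 : Set
  Girth≥5 = ∀ C → IsCycle C → 5 ≤ length C

  Independent3 : V → V → V → Set
  Independent3 a b c = a ≢ b × b ≢ c × a ≢ c × ¬ Adj a b × ¬ Adj b c × ¬ Adj a c

  AvoidsN : V → List V → Set
  AvoidsN c W = All (λ w → ¬ Adj w c) W

  AsteroidalTriple : V → V → V → Set
  AsteroidalTriple a b c = Independent3 a b c
    × (∃[ W ] (IsPath a b W × AvoidsN c W))
    × (∃[ W ] (IsPath b c W × AvoidsN a W))
    × (∃[ W ] (IsPath a c W × AvoidsN b W))

  ATFree : Set
  ATFree = ∀ a b c → ¬ AsteroidalTriple a b c

  Dominating : List V → Set
  Dominating D = ∀ v → v ∈ D ⊎ ∃[ w ] (w ∈ D × Adj v w)

  DominatingPair : V → V → Set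
  DominatingPair x y = ∀ W → IsPath x y W → Dominating W

  -- Sets attached to the path P = u₁ … u_d (1-based indexing)

  module _ (P : List V) where

    -- u_i = v  (only possible for 1 ≤ i ≤ d)
    At : ℕ → V → Set
    At i v = Σ (Fin (length P)) λ k → suc (toℕ k) ≡ i × lookup P k ≡ v

    -- v ∈ S_i  (S_i = ∅ automatically for i ∉ {1,…,d})
    InS : ℕ → V → Set
    InS i v = v ∉ P × ∃[ w ] (At i w × Adj v w)

    InSS : V → Set
    InSS v = v ∉ P × ∃[ w ] (w ∉ P × Adj v w)

    MeetsS : V → ℕ → Set
    MeetsS v j = ∃[ w ] (Adj v w × InS j w)

    -- L lists the elements of S_i \ S without repetition (v_{i,1}, v_{i,2}, …)
    Enumerates : ℕ → List V → Set
    Enumerates i L = Unique L × (∀ v → (v ∈ L) ⇔ (InS i v × ¬ InSS v))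

-- Closed intervals with rational endpoints [lo , hi]

Interval : Set
Interval = ℚ × ℚ

Intersect : Interval → Interval → Set
Intersect (a , b) (c , d) = ∃[ q ] ((a ℚ.≤ q × q ℚ.≤ b) × (c ℚ.≤ q × q ℚ.≤ d))

IntAdj : ∀ {n} → (Fin n → Interval) → Fin n → Fin n → Set
IntAdj g u v = u ≢ v × Intersect (g u) (g v)

q : ℕ → ℚ
q m = + m / 1

frac : ℕ → (b : ℕ) → .{{NonZero b}} → ℚ
frac a b = + a / b

module _ {n : ℕ} .{{nz : NonZero n}} (G : Graph n) (P : List (Fin n)) where

  private
    instance nz2 : NonZero (2 ℕ.* n)
    nz2 = m*n≢0 2 n

  G1Spec : (ℕ → List (Fin n)) → (Fin n → Interval) → Set
  G1Spec enum g =
      (∀ i v → At G P i v → g v ≡ (q i , q (suc i)))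
    × (∀ i (k : Fin (length (enum i))) →
         let j = suc (toℕ k) in
         g (lookup (enum i) k)
           ≡ (q i ℚ.+ (+ (2 ℕ.* j ∸ 1) / (2 ℕ.* n)) , q i ℚ.+ (+ (2 ℕ.* j) / (2 ℕ.* n))))
    × (∀ i v → InS G P i v → InSS G P v →
         (MeetsS G P v (i ∸ 2) → MeetsS G P v (i ℕ.+ 2) →
            g v ≡ (q i ℚ.- ½ , q i ℚ.+ frac 3 2))
       × (¬ MeetsS G P v (i ∸ 2) → MeetsS G P v (i ℕ.+ 2) →
            g v ≡ (q (suc i) , q i ℚ.+ frac 3 2))
       × (MeetsS G P v (i ∸ 2) → ¬ MeetsS G P v (i ℕ.+ 2) →
            g v ≡ (q i ℚ.- ½ , q i)))

  G2Spec : (Fin n → Interval) → Set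
  G2Spec g =
      (∀ i v → At G P i v →
         (i % 2 ≡ 1 → g v ≡ (q 1 , q 2)) × (i % 2 ≡ 0 → g v ≡ (q 2 , q 3)))
    × (∀ i v → InS G P i v → ¬ InSS G P v →
         (i % 2 ≡ 1 → g v ≡ (frac 5 4 , frac 7 4)) × (i % 2 ≡ 0 → g v ≡ (frac 9 4 , frac 11 4)))
    × (∀ i v → InS G P i v → InSS G P v →
         (i % 2 ≡ 1 → g v ≡ (q 0 , q 1)) × (i % 2 ≡ 0 → g v ≡ (q 3 , q 4)))

module Submission where

open import Defs
open import Data.Nat using (ℕ; NonZero)
open import Data.Fin using (Fin)
open import Data.List using (List)
open import Data.Sum using (_⊎_)
open import Relation.Nullary using (¬_)
open import Relation.Binary.PropositionalEquality using (_≢_)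

open import Data.Bool using (T)
open import Data.Empty using (⊥; ⊥-elim)
open import Data.Fin as Fin using (toℕ)
import Data.Fin.Properties as FinP
open import Data.Integer as ℤ using (+_)
import Data.Integer.Properties as ℤP
open import Data.List using ([]; _∷_; length; lookup; head; last)
open import Data.List.Membership.Propositional using (_∈_; _∉_)
open import Data.List.Membership.Propositional.Properties using (∈-lookup)
import Data.List.Membership.DecPropositional as DecMembership
open import Data.List.Relation.Unary.All as All using ([]; _∷_)
open import Data.List.Relation.Unary.AllPairs using ([]; _∷_)
open import Data.List.Relation.Unary.Any using (index)
open import Data.List.Relation.Unary.Any.Properties using (lookup-index)
open import Data.List.Relation.Unary.Linked using (Linked; []; [-]; _∷_)
open import Data.List.Relation.Unary.Unique.Propositional using (Unique)
open import Data.Maybe using (just)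
open import Data.Nat as ℕ using (parity; zero; suc; _+_; _*_; _∸_; _≤_; _<_; _%_; z≤n; s≤s)
import Data.Nat.Properties as ℕP
open import Data.Parity.Base using (Parity; 0ℙ; 1ℙ; _⁻¹)
import Data.Parity.Properties as ParityP
open import Data.Product using (∃-syntax; _×_; _,_; proj₁; proj₂)
open import Data.Rational as ℚ using (ℚ; ½; 0ℚ; 1ℚ; toℚᵘ)
import Data.Rational.Properties as ℚP
import Data.Rational.Unnormalised as ℚᵘ
import Data.Rational.Unnormalised.Properties as ℚᵘP
open import Data.Sum as Sum using (inj₁; inj₂; [_,_]′; fromInj₁; fromInj₂; swap)
open import Function using (_∘_)
open import Function.Bundles using (Equivalence)
open import Relation.Binary.Definitions using (Tri; tri<; tri≈; tri>)
open import Relation.Binary.PropositionalEquality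
  using (_≡_; refl; sym; trans; cong; cong₂; subst; subst₂)
open import Relation.Nullary using (Dec; yes; no)
open import Relation.Nullary.Decidable using (True; toWitness; T?; ¬?; _×-dec_; _⊎-dec_)

-- Every vertex gets an index i and one of three roles: the path vertex uᵢ, a
-- "pendant" vertex of Sᵢ ∖ S, or a "branch" vertex of Sᵢ ∩ S (the dominating pair
-- puts every vertex off P into some Sᵢ).  P is a geodesic, so a walk from uᵢ to
-- uⱼ has at least |j - i| edges; with girth ≥ 5 this makes uᵢ the only neighbour
-- on P of a vertex in Sᵢ, and AT-freeness forces a branch vertex of Sᵢ to see
-- S_{i-2} or S_{i+2}, forbids two non-adjacent vertices of Sᵢ seeing the same
-- side, and forbids "crossing" pairs between Sᵢ and S_{i+2}.  g₁ keeps a vertex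
-- of index i inside the window [i - ½, i + 3/2] (path and pendant vertices inside
-- [i, i + 1]), so it separates indices two or more apart and equal indices;
-- g₂ depends only on role and parity, and separates consecutive indices.

toℚᵘ-frac : ∀ a d → toℚᵘ (+ a ℚ./ suc d) ℚᵘ.≃ ℚᵘ.mkℚᵘ (+ a) d
toℚᵘ-frac a d = ℚP.toℚᵘ-fromℚᵘ (ℚᵘ.mkℚᵘ (+ a) d)

frac-≤ : ∀ {a b} d e → a * suc e ≤ b * suc d → + a ℚ./ suc d ℚ.≤ + b ℚ./ suc e
frac-≤ {a} {b} d e le = ℚP.toℚᵘ-cancel-≤
  (ℚᵘP.≤-respʳ-≃ (ℚᵘP.≃-sym (toℚᵘ-frac b e)) (ℚᵘP.≤-respˡ-≃ (ℚᵘP.≃-sym (toℚᵘ-frac a d))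
    (ℚᵘ.*≤* (subst₂ ℤ._≤_ (ℤP.pos-* a (suc e)) (ℤP.pos-* b (suc d)) (ℤ.+≤+ le)))))

frac-< : ∀ {a b} d e → a * suc e < b * suc d → + a ℚ./ suc d ℚ.< + b ℚ./ suc e
frac-< {a} {b} d e lt = ℚP.toℚᵘ-cancel-<
  (ℚᵘP.<-respʳ-≃ (ℚᵘP.≃-sym (toℚᵘ-frac b e)) (ℚᵘP.<-respˡ-≃ (ℚᵘP.≃-sym (toℚᵘ-frac a d))
    (ℚᵘ.*<* (subst₂ ℤ._<_ (ℤP.pos-* a (suc e)) (ℤP.pos-* b (suc d)) (ℤ.+<+ lt)))))

q-+ : ∀ a b → q (a + b) ≡ q a ℚ.+ q b
q-+ a b = ℚP.toℚᵘ-injective (begin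
    toℚᵘ (q (a + b))                       ≈⟨ toℚᵘ-frac (a + b) 0 ⟩
    ℚᵘ.mkℚᵘ (+ (a + b)) 0                  ≈⟨ ℚᵘ.*≡* (cong (ℤ._* + 1) sum-numerator) ⟩
    ℚᵘ.mkℚᵘ (+ a) 0 ℚᵘ.+ ℚᵘ.mkℚᵘ (+ b) 0   ≈⟨ ℚᵘP.+-cong (toℚᵘ-frac a 0) (toℚᵘ-frac b 0) ⟨
    toℚᵘ (q a) ℚᵘ.+ toℚᵘ (q b)             ≈⟨ ℚP.toℚᵘ-homo-+ (q a) (q b) ⟨
    toℚᵘ (q a ℚ.+ q b)                     ∎)
  where
  open import Relation.Binary.Reasoning.Setoid ℚᵘP.≃-setoid
  sum-numerator : + (a + b) ≡ + a ℤ.* + 1 ℤ.+ + b ℤ.* + 1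
  sum-numerator = trans (ℤP.pos-+ a b)
    (cong₂ ℤ._+_ (sym (ℤP.*-identityʳ (+ a))) (sym (ℤP.*-identityʳ (+ b))))

q-mono-≤ : ∀ {a b} → a ≤ b → q a ℚ.≤ q b
q-mono-≤ {a} {b} a≤b = frac-≤ {a} {b} 0 0 (ℕP.*-monoˡ-≤ 1 a≤b)

lt! : ∀ a b → {True (a ℚ.<? b)} → a ℚ.< b
lt! a b {w} = toWitness w

le! : ∀ a b → {True (a ℚ.≤? b)} → a ℚ.≤ b
le! a b {w} = toWitness w

q-suc : ∀ i → q (suc i) ≡ q i ℚ.+ 1ℚ
q-suc i = trans (q-+ 1 i) (ℚP.+-comm 1ℚ (q i))

Within : Interval → ℚ → ℚ → Set
Within (lo , hi) a b = a ℚ.≤ lo × hi ℚ.≤ b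

Intersect-sym : ∀ x y → Intersect x y → Intersect y x
Intersect-sym (a , b) (c , d) (t , in-x , in-y) = t , in-y , in-x

within-≡ : ∀ {x a b} → x ≡ (a , b) → Within x a b
within-≡ refl = ℚP.≤-refl , ℚP.≤-refl

within-widen : ∀ {x a b a′ b′} → a′ ℚ.≤ a → b ℚ.≤ b′ → Within x a b → Within x a′ b′
within-widen {_ , _} a′≤a b≤b′ (a≤lo , hi≤b) = ℚP.≤-trans a′≤a a≤lo , ℚP.≤-trans hi≤b b≤b′

below-disjoint : ∀ {x y a b c d} → Within x a b → Within y c d → b ℚ.< c → ¬ Intersect x y
below-disjoint {_ , _} {_ , _} (_ , hi≤b) (c≤lo′ , _) b<c (t , (_ , t≤hi) , (lo′≤t , _)) =
  ℚP.<-irrefl refl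
    (ℚP.≤-<-trans (ℚP.≤-trans c≤lo′ (ℚP.≤-trans lo′≤t (ℚP.≤-trans t≤hi hi≤b))) b<c)

data Window (x : Interval) (i : ℕ) (α β : ℚ) : Set where
  in-window : Within x (q i ℚ.+ α) (q i ℚ.+ β) → Window x i α β

window-≡ : ∀ {x i α β} → x ≡ (q i ℚ.+ α , q i ℚ.+ β) → Window x i α β
window-≡ eq = in-window (within-≡ eq)

window-widen : ∀ {x i α β α′ β′} → α′ ℚ.≤ α → β ℚ.≤ β′ → Window x i α β → Window x i α′ β′
window-widen {i = i} α′≤α β≤β′ (in-window w) =
  in-window (within-widen (ℚP.+-monoʳ-≤ (q i) α′≤α) (ℚP.+-monoʳ-≤ (q i) β≤β′) w)

window-gap : ∀ {x y i d m α β γ δ} → Window x i α β → Window y (d + i) γ δ →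
  m ≤ d → β ℚ.< q m ℚ.+ γ → ¬ Intersect x y
window-gap {i = i} {d} {m} {α} {β} {γ} (in-window wx) (in-window wy) m≤d β<m+γ =
  below-disjoint wx wy (begin-strict
    q i ℚ.+ β             <⟨ ℚP.+-monoʳ-< (q i) β<m+γ ⟩
    q i ℚ.+ (q m ℚ.+ γ)   ≡⟨ sym (ℚP.+-assoc (q i) (q m) γ) ⟩
    (q i ℚ.+ q m) ℚ.+ γ   ≡⟨ cong (ℚ._+ γ) (trans (ℚP.+-comm (q i) (q m)) (sym (q-+ m i))) ⟩
    q (m + i) ℚ.+ γ       ≤⟨ ℚP.+-monoˡ-≤ γ (q-mono-≤ (ℕP.+-monoˡ-≤ i m≤d)) ⟩
    q (d + i) ℚ.+ γ       ∎)
  where open ℚP.≤-Reasoning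

Apart : Interval → Interval → Set
Apart (a , b) (c , d) = b ℚ.< c ⊎ d ℚ.< a

apart? : ∀ x y → Dec (Apart x y)
apart? (a , b) (c , d) = (b ℚ.<? c) ⊎-dec (d ℚ.<? a)

apart! : ∀ x y → {True (apart? x y)} → ¬ Intersect x y
apart! (a , b) (c , d) {w} with toWitness w
... | inj₁ b<c = below-disjoint (within-≡ refl) (within-≡ refl) b<c
... | inj₂ d<a = λ meet → below-disjoint (within-≡ refl) (within-≡ refl) d<a
                            (Intersect-sym (a , b) (c , d) meet)

data Offset : ℕ → ℕ → Set where
  ahead  : ∀ d {i} → Offset i (d + i)
  behind : ∀ d {j} → Offset (d + j) j

offset : ∀ i j → Offset i j
offset i j with ℕP.≤-total i j
... | inj₁ i≤j = subst (Offset i) (ℕP.m∸n+n≡m i≤j) (ahead (j ∸ i))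
... | inj₂ j≤i = subst (λ k → Offset k j) (ℕP.m∸n+n≡m j≤i) (behind (i ∸ j))

offset-≢ : ∀ {d e} i → d ≢ e → d + i ≢ e + i
offset-≢ {d} {e} i d≢e eq = d≢e (ℕP.+-cancelʳ-≡ i d e eq)

lookup-injective : ∀ {A : Set} {xs : List A} → Unique xs →
  (k l : Fin (length xs)) → lookup xs k ≡ lookup xs l → k ≡ l
lookup-injective (_ ∷ _)      Fin.zero    Fin.zero    _ = refl
lookup-injective (x∉ ∷ _)     Fin.zero    (Fin.suc l) e = ⊥-elim (All.lookup x∉ (∈-lookup l) e)
lookup-injective (x∉ ∷ _)     (Fin.suc k) Fin.zero    e = ⊥-elim (All.lookup x∉ (∈-lookup k) (sym e))
lookup-injective (_ ∷ unique) (Fin.suc k) (Fin.suc l) e = cong Fin.suc (lookup-injective unique k l e)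

unique-length : ∀ {n} {xs : List (Fin n)} → Unique xs → length xs ≤ n
unique-length unique = FinP.injective⇒≤ (λ {k} {l} → lookup-injective unique k l)

linked-lookup : ∀ {A : Set} {R : A → A → Set} {xs} → Linked R xs →
  (k l : Fin (length xs)) → suc (toℕ k) ≡ toℕ l → R (lookup xs k) (lookup xs l)
linked-lookup (r ∷ _) Fin.zero    (Fin.suc Fin.zero) _ = r
linked-lookup (_ ∷ l) (Fin.suc k) (Fin.suc k′)      e = linked-lookup l k k′ (ℕP.suc-injective e)
linked-lookup [-]     Fin.zero    Fin.zero           ()
linked-lookup (_ ∷ _) Fin.zero    Fin.zero           ()
linked-lookup (_ ∷ _) Fin.zero    (Fin.suc (Fin.suc _)) ()
linked-lookup (_ ∷ _) (Fin.suc _) Fin.zero           ()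

module _ {n : ℕ} (G : Graph n) where

  data Walk : ℕ → Fin n → Fin n → Set where
    []  : ∀ {a} → Walk 0 a a
    _∷_ : ∀ {a b c s} → Adj G a b → Walk s b c → Walk (suc s) a c

  infixr 5 _++ʷ_
  _++ʷ_ : ∀ {a b c s t} → Walk s a b → Walk t b c → Walk (s + t) a c
  []      ++ʷ w′ = w′
  (e ∷ w) ++ʷ w′ = e ∷ (w ++ʷ w′)

  vertices : ∀ {a b s} → Walk s a b → List (Fin n)
  vertices {a} []      = a ∷ []
  vertices {a} (_ ∷ w) = a ∷ vertices w

  length-vertices : ∀ {a b s} (w : Walk s a b) → length (vertices w) ≡ suc s
  length-vertices []      = refl
  length-vertices (_ ∷ w) = cong suc (length-vertices w)

  vertices-isWalk : ∀ {a b s} (w : Walk s a b) → IsWalk G a b (vertices w)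
  vertices-isWalk w = linked w , head-vertices w , last-vertices w
    where
    head-vertices : ∀ {a b s} (w : Walk s a b) → head (vertices w) ≡ just a
    head-vertices []      = refl
    head-vertices (_ ∷ _) = refl
    linked : ∀ {a b s} (w : Walk s a b) → Linked (Adj G) (vertices w)
    linked []            = [-]
    linked (e ∷ [])      = e ∷ [-]
    linked (e ∷ e′ ∷ w)  = e ∷ linked (e′ ∷ w)
    last-vertices : ∀ {a b s} (w : Walk s a b) → last (vertices w) ≡ just b
    last-vertices []           = refl
    last-vertices (_ ∷ [])     = refl
    last-vertices (_ ∷ e′ ∷ w) = last-vertices (e′ ∷ w)

  prefix : ∀ {z zs} → Linked (Adj G) (z ∷ zs) → (k : Fin (length (z ∷ zs))) →
    Walk (toℕ k) z (lookup (z ∷ zs) k)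
  prefix _ Fin.zero = []
  prefix {zs = []}    _       (Fin.suc ())
  prefix {zs = _ ∷ _} (e ∷ l) (Fin.suc k) = e ∷ prefix l k

  suffix : ∀ {z zs y} → Linked (Adj G) (z ∷ zs) → last (z ∷ zs) ≡ just y →
    (k : Fin (length (z ∷ zs))) → Walk (length zs ∸ toℕ k) (lookup (z ∷ zs) k) y
  suffix {zs = []}    _       refl Fin.zero    = []
  suffix {zs = []}    _       _    (Fin.suc ())
  suffix {zs = _ ∷ _} (e ∷ l) end  Fin.zero    = e ∷ suffix l end Fin.zero
  suffix {zs = _ ∷ _} (_ ∷ l) end  (Fin.suc k) = suffix l end k

  IsGeodesic : Fin n → Fin n → List (Fin n) → Set
  IsGeodesic x y P = IsWalk G x y P × (∀ W → IsWalk G x y W → length P ≤ length W)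

  shortest-geodesic : ∀ {x y k P} → IsDist G x y k → IsShortestPath G x y P → IsGeodesic x y P
  shortest-geodesic ((P₀ , path₀ , length₀) , no-shorter) ((walk , _) , shortest) =
    walk , λ W w → ℕP.≤-trans (shortest P₀ path₀)
                     (ℕP.≤-trans (ℕP.≤-reflexive length₀) (no-shorter W w))

  geodesic-lookup : ∀ {x y s} P → IsGeodesic x y P → (k l : Fin (length P)) →
    Walk s (lookup P k) (lookup P l) → toℕ l ≤ s + toℕ k
  geodesic-lookup [] ((_ , () , _) , _)
  geodesic-lookup {s = s} (z ∷ zs) ((linked , refl , end) , minimal) k l w =
    ℕP.+-cancelʳ-≤ rest (toℕ l) (s + toℕ k) (begin
      toℕ l + rest                   ≡⟨ ℕP.m+[n∸m]≡n (FinP.toℕ≤pred[n] l) ⟩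
      length zs                      ≤⟨ ℕP.≤-pred (subst (suc (length zs) ≤_)
                                          (length-vertices detour) (minimal _ (vertices-isWalk detour))) ⟩
      toℕ k + (s + rest)             ≡⟨ sym (ℕP.+-assoc (toℕ k) s rest) ⟩
      toℕ k + s + rest               ≡⟨ cong (_+ rest) (ℕP.+-comm (toℕ k) s) ⟩
      s + toℕ k + rest               ∎)
    where
    open ℕP.≤-Reasoning
    rest = length zs ∸ toℕ l
    detour = prefix linked k ++ʷ w ++ʷ suffix linked end l

module Adjacency {n : ℕ} (G : Graph n) where

  adj-sym : ∀ {a b} → Adj G a b → Adj G b a
  adj-sym {a} {b} = subst T (Graph.sym G a b)

  adj-≢ : ∀ {a b} → Adj G a b → a ≢ b
  adj-≢ {a} ab refl = subst T (Graph.irrefl G a) ab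

  adj? : ∀ a b → Dec (Adj G a b)
  adj? a b = T? (Graph.adj G a b)

  ¬adj-sym : ∀ {a b} → ¬ Adj G a b → ¬ Adj G b a
  ¬adj-sym ¬ab ba = ¬ab (adj-sym ba)

  no-triangle : Girth≥5 G → ∀ {a b c} → Adj G a b → Adj G b c → Adj G c a → ⊥
  no-triangle girth {a} {b} {c} ab bc ca
    with girth (a ∷ b ∷ c ∷ []) (s≤s (s≤s z≤n) , distinct , ab ∷ bc ∷ ca ∷ [-])
    where distinct = (adj-≢ ab ∷ (λ a≡c → adj-≢ ca (sym a≡c)) ∷ []) ∷ (adj-≢ bc ∷ []) ∷ [] ∷ []
  ... | s≤s (s≤s (s≤s ()))

  no-square : Girth≥5 G → ∀ {a b c d} → Adj G a b → Adj G b c → Adj G c d → Adj G d a →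
    a ≢ c → b ≢ d → ⊥
  no-square girth {a} {b} {c} {d} ab bc cd da a≢c b≢d
    with girth (a ∷ b ∷ c ∷ d ∷ []) (s≤s (s≤s z≤n) , distinct , ab ∷ bc ∷ cd ∷ da ∷ [-])
    where distinct = (adj-≢ ab ∷ a≢c ∷ (λ a≡d → adj-≢ da (sym a≡d)) ∷ [])
                   ∷ (adj-≢ bc ∷ b≢d ∷ []) ∷ (adj-≢ cd ∷ []) ∷ [] ∷ []
  ... | s≤s (s≤s (s≤s (s≤s ())))

  two-edge-path : ∀ {a m b} → Adj G a m → Adj G m b → a ≢ b → IsPath G a b (a ∷ m ∷ b ∷ [])
  two-edge-path am mb a≢b =
    (am ∷ mb ∷ [-] , refl , refl) , (adj-≢ am ∷ a≢b ∷ []) ∷ (adj-≢ mb ∷ []) ∷ [] ∷ []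

  asteroidal : ∀ {a b c m₁ m₂ m₃} → Independent3 G a b c →
    Adj G a m₁ → Adj G m₁ b → ¬ Adj G m₁ c →
    Adj G b m₂ → Adj G m₂ c → ¬ Adj G m₂ a →
    Adj G a m₃ → Adj G m₃ c → ¬ Adj G m₃ b →
    AsteroidalTriple G a b c
  asteroidal indep@(a≢b , b≢c , a≢c , ¬ab , ¬bc , ¬ac)
    am₁ m₁b ¬m₁c bm₂ m₂c ¬m₂a am₃ m₃c ¬m₃b =
    indep
    , (_ , two-edge-path am₁ m₁b a≢b , ¬ac ∷ ¬m₁c ∷ ¬bc ∷ [])
    , (_ , two-edge-path bm₂ m₂c b≢c , ¬adj-sym ¬ab ∷ ¬m₂a ∷ ¬adj-sym ¬ac ∷ [])
    , (_ , two-edge-path am₃ m₃c a≢c , ¬ab ∷ ¬m₃b ∷ ¬adj-sym ¬bc ∷ [])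

module OnGeodesic {n : ℕ} (G : Graph n) {x y : Fin n} {P : List (Fin n)}
                  (geodesic : IsGeodesic G x y P) where

  open Adjacency G

  position-gap : ∀ {i j s a b} → At G P i a → At G P j b → Walk G s a b → j ≤ s + i
  position-gap {s = s} (k , refl , refl) (l , refl , refl) w =
    subst (suc (toℕ l) ≤_) (sym (ℕP.+-suc s (toℕ k))) (s≤s (geodesic-lookup G P geodesic k l w))

  position-offset : ∀ {i d s a b} → At G P i a → At G P (d + i) b → Walk G s a b → d ≤ s
  position-offset {i} {d} {s} A B w = ℕP.+-cancelʳ-≤ i d s (position-gap A B w)

  same-position : ∀ {i a b} → At G P i a → At G P i b → a ≡ b
  same-position (k , e , refl) (k′ , e′ , refl) =
    cong (lookup P) (FinP.toℕ-injective (ℕP.suc-injective (trans e (sym e′))))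

  same-vertex : ∀ {i j a} → At G P i a → At G P j a → i ≡ j
  same-vertex A A′ = ℕP.≤-antisym (position-gap A′ A []) (position-gap A A′ [])

  distinct-positions : ∀ {i j a b} → At G P i a → At G P j b → i ≢ j → a ≢ b
  distinct-positions A B i≢j refl = i≢j (same-vertex A B)

  path-step : ∀ {i a b} → At G P i a → At G P (suc i) b → Adj G a b
  path-step (k , e , refl) (l , e′ , refl) =
    linked-lookup (proj₁ (proj₁ geodesic)) k l (ℕP.suc-injective (trans (cong suc e) (sym e′)))

  far-apart : ∀ {i d a b} → At G P i a → At G P (2 + d + i) b → ¬ Adj G a b
  far-apart A B ab with position-offset A B (ab ∷ [])
  ... | s≤s ()

  two-apart : ∀ {i j a b} → At G P i a → At G P j b → (j ≡ 2 + i ⊎ i ≡ 2 + j) →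
    j ≢ i × ¬ Adj G a b
  two-apart {i} A B (inj₁ refl) = offset-≢ i (λ ()) , far-apart {d = 0} A B
  two-apart {j = j} A B (inj₂ refl) =
    (λ j≡i → offset-≢ j (λ ()) (sym j≡i)) , ¬adj-sym (far-apart {d = 0} B A)

  between-position : ∀ {i d e a b} → At G P i a → At G P (d + i) b → e ≤ d →
    ∃[ c ] At G P (e + i) c
  between-position {d = d} {e} (k , refl , _) (l , eq , _) e≤d =
    lookup P (Fin.fromℕ< bound) , Fin.fromℕ< bound , position , refl
    where
    open ℕP.≤-Reasoning
    bound : e + toℕ k < length P
    bound = begin-strict
      e + toℕ k            <⟨ ℕP.n<1+n _ ⟩
      suc (e + toℕ k)      ≡⟨ sym (ℕP.+-suc e (toℕ k)) ⟩
      e + suc (toℕ k)      ≤⟨ ℕP.+-monoˡ-≤ (suc (toℕ k)) e≤d ⟩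
      d + suc (toℕ k)      ≡⟨ sym eq ⟩
      suc (toℕ l)          ≤⟨ FinP.toℕ<n l ⟩
      length P             ∎
    position : suc (toℕ (Fin.fromℕ< bound)) ≡ e + suc (toℕ k)
    position = trans (cong suc (FinP.toℕ-fromℕ< bound)) (sym (ℕP.+-suc e (toℕ k)))

  off-path-≢ : ∀ {i v a} → v ∉ P → At G P i a → v ≢ a
  off-path-≢ v∉P (k , _ , refl) refl = v∉P (∈-lookup k)

  attached : ∀ {i a v} → At G P i a → InS G P i v → Adj G a v
  attached A (_ , c , C , vc) = adj-sym (subst (Adj G _) (same-position C A) vc)

  module WithGirth (girth : Girth≥5 G) where

    single-anchor : ∀ {v i d a b} → v ∉ P → At G P i a → Adj G v a →
      At G P (d + i) b → Adj G v b → d ≡ 0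
    single-anchor {d = 0} _ _ _ _ _ = refl
    single-anchor {d = 1} _ A va B vb = ⊥-elim (no-triangle girth va (path-step A B) (adj-sym vb))
    single-anchor {i = i} {d = 2} v∉P A va B vb with between-position {e = 1} A B (s≤s z≤n)
    ... | c , C = ⊥-elim (no-square girth va (path-step A C) (path-step C B) (adj-sym vb)
                            (off-path-≢ v∉P C) (distinct-positions A B (offset-≢ i λ ())))
    single-anchor {d = suc (suc (suc _))} _ A va B vb
      with position-offset A B (adj-sym va ∷ vb ∷ [])
    ... | s≤s (s≤s ())

    sole-anchor : ∀ {i j v b} → InS G P i v → At G P j b → Adj G v b → j ≡ i
    sole-anchor {i} {j} (v∉P , a , A , va) B vb with offset i j
    ... | ahead d  = cong (_+ i) (single-anchor v∉P A va B vb)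
    ... | behind d = sym (cong (_+ j) (single-anchor v∉P B vb A va))

    not-anchored : ∀ {i j v b} → InS G P i v → At G P j b → j ≢ i → ¬ Adj G v b
    not-anchored S B j≢i vb = j≢i (sole-anchor S B vb)

    module WithATFree (at : ATFree G) where

      -- no edge joins Sᵢ to S_{i+3}: otherwise uᵢ, w, u_{i+2} is an asteroidal triple
      no-jump-by-three : ∀ {i v w} → InS G P i v → InS G P (3 + i) w → Adj G v w → ⊥
      no-jump-by-three {i} {w = w} S@(v∉P , a₀ , A₀ , va₀) T@(w∉P , d , D , wd) vw
        with between-position {e = 1} A₀ D (s≤s z≤n)
           | between-position {e = 2} A₀ D (s≤s (s≤s z≤n))
      ... | b₁ , B₁ | b₂ , B₂ =
        at a₀ w b₂ (asteroidal independent
          (adj-sym va₀) vw (not-anchored S B₂ (offset-≢ i λ ()))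
          wd (adj-sym (path-step B₂ D)) (¬adj-sym (far-apart {d = 1} A₀ D))
          (path-step A₀ B₁) (path-step B₁ B₂) (¬adj-sym (not-anchored T B₁ (offset-≢ i λ ()))))
        where
        independent : Independent3 G a₀ w b₂
        independent = (λ a₀≡w → off-path-≢ w∉P A₀ (sym a₀≡w)) , off-path-≢ w∉P B₂
                    , distinct-positions A₀ B₂ (offset-≢ i λ ())
                    , ¬adj-sym (not-anchored T A₀ (offset-≢ i λ ()))
                    , not-anchored T B₂ (offset-≢ i λ ()) , far-apart {d = 0} A₀ B₂

      neighbour-offset : ∀ {i d v w} → InS G P i v → InS G P (d + i) w → Adj G v w → d ≡ 2
      neighbour-offset {d = 0} (_ , a₀ , A₀ , va₀) (_ , c , C , wc) vw =
        ⊥-elim (no-triangle girth va₀ (adj-sym (subst (Adj G _) (same-position C A₀) wc)) (adj-sym vw))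
      neighbour-offset {d = 1} (v∉P , a₀ , A₀ , va₀) (w∉P , c , C , wc) vw =
        ⊥-elim (no-square girth va₀ (path-step A₀ C) (adj-sym wc) (adj-sym vw)
                  (off-path-≢ v∉P C) (λ a₀≡w → off-path-≢ w∉P A₀ (sym a₀≡w)))
      neighbour-offset {d = 2} _ _ _ = refl
      neighbour-offset {d = 3} S T vw = ⊥-elim (no-jump-by-three S T vw)
      neighbour-offset {d = suc (suc (suc (suc _)))} (_ , a₀ , A₀ , va₀) (_ , c , C , wc) vw
        with position-offset A₀ C (adj-sym va₀ ∷ vw ∷ wc ∷ [])
      ... | s≤s (s≤s (s≤s ()))

      branch-meets : ∀ {i j v w} → InS G P i v → InS G P j w → Adj G v w →
        MeetsS G P v (i ∸ 2) ⊎ MeetsS G P v (i + 2)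
      branch-meets {i} {j} S T vw with offset i j
      branch-meets {i} {w = w} S T vw | ahead d with neighbour-offset S T vw
      ... | refl = inj₂ (w , vw , subst (λ k → InS G P k w) (ℕP.+-comm 2 i) T)
      branch-meets {w = w} S T vw | behind d with neighbour-offset T S (adj-sym vw)
      ... | refl = inj₁ (w , vw , T)

      -- two non-adjacent vertices of Sᵢ never both see S_j for j = i ± 2:
      -- otherwise v, w, u_j is an asteroidal triple
      no-common-side : ∀ {i j v w} → InS G P i v → InS G P i w → v ≢ w → ¬ Adj G v w →
        (j ≡ 2 + i ⊎ i ≡ 2 + j) → MeetsS G P v j → MeetsS G P w j → ⊥
      no-common-side {v = v} {w} S@(v∉P , a₀ , A₀ , va₀) T@(w∉P , a₀′ , A₀′ , wa₀′) v≢w ¬vw apart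
                     (a , va , a∉P , c , C , ac) (b , wb , b∉P , c′ , C′ , bc′)
        with same-position A₀′ A₀ | same-position C′ C
      ... | refl | refl =
        at v w c (asteroidal independent
          va₀ (adj-sym wa₀′) ¬a₀c
          wb bc′ (λ bv → no-square girth va₀ (adj-sym wa₀′) wb bv v≢w (≢-off b∉P))
          va ac (λ aw → no-square girth wa₀′ (adj-sym va₀) va aw (λ w≡v → v≢w (sym w≡v)) (≢-off a∉P)))
        where
        j≢i = proj₁ (two-apart A₀ C apart)
        ¬a₀c = proj₂ (two-apart A₀ C apart)
        ≢-off : ∀ {z} → z ∉ P → a₀ ≢ z
        ≢-off z∉P a₀≡z = off-path-≢ z∉P A₀ (sym a₀≡z)
        independent : Independent3 G v w c
        independent = v≢w , off-path-≢ w∉P C , off-path-≢ v∉P C , ¬vw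
                    , not-anchored T C j≢i , not-anchored S C j≢i

      -- if v ∈ Sᵢ sees S_{i+2} through a, then no vertex w ∈ S_{i+2} non-adjacent to v
      -- sees Sᵢ: otherwise uᵢ, a, w is an asteroidal triple
      no-crossing : ∀ {i v w} → InS G P i v → MeetsS G P v (2 + i) →
        InS G P (2 + i) w → MeetsS G P w i → v ≢ w → ¬ Adj G v w → ⊥
      no-crossing {i} {v} {w} S@(v∉P , a₀ , A₀ , va₀) (a , va , a∉P , c , C , ac)
                  T@(w∉P , c′ , C′ , wc′) (b , wb , b∉P , a₀′ , A₀′ , ba₀′) v≢w ¬vw
        with same-position C′ C | same-position A₀′ A₀
      ... | refl | refl =
        at a₀ a w (asteroidal independent
          (adj-sym va₀) va ¬vw
          ac (adj-sym wc′) (¬adj-sym (far-apart {d = 0} A₀ C))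
          (adj-sym ba₀′) (adj-sym wb)
          (λ ba → no-square girth va (adj-sym ba) ba₀′ (adj-sym va₀)
                    (λ v≡b → ¬vw (adj-sym (subst (Adj G w) (sym v≡b) wb))) (off-path-≢ a∉P A₀)))
        where
        independent : Independent3 G a₀ a w
        independent = (λ a₀≡a → off-path-≢ a∉P A₀ (sym a₀≡a))
                    , (λ a≡w → ¬vw (subst (Adj G v) a≡w va))
                    , (λ a₀≡w → off-path-≢ w∉P A₀ (sym a₀≡w))
                    , (λ a₀a → no-triangle girth va₀ a₀a (adj-sym va))
                    , (λ aw → no-triangle girth aw wc′ (adj-sym ac))
                    , ¬adj-sym (not-anchored T A₀ (offset-≢ i λ ()))

-- the interval g₂ gives a vertex depends only on its role and the parity of its index
data Role : Set where
  path-vertex pendant-vertex branch-vertex : Role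

column : Role → Parity → Interval
column path-vertex    1ℙ = q 1 , q 2
column path-vertex    0ℙ = q 2 , q 3
column pendant-vertex 1ℙ = frac 5 4 , frac 7 4
column pendant-vertex 0ℙ = frac 9 4 , frac 11 4
column branch-vertex  1ℙ = q 0 , q 1
column branch-vertex  0ℙ = q 3 , q 4

-- odd columns lie left of even ones; only two path intervals touch (at 2)
odd-even-apart : ∀ r r′ → r ≢ path-vertex ⊎ r′ ≢ path-vertex →
  ¬ Intersect (column r 1ℙ) (column r′ 0ℙ)
odd-even-apart path-vertex    path-vertex    (inj₁ r≢p) = ⊥-elim (r≢p refl)
odd-even-apart path-vertex    path-vertex    (inj₂ r≢p) = ⊥-elim (r≢p refl)
odd-even-apart path-vertex    pendant-vertex _ = apart! (column path-vertex 1ℙ) (column pendant-vertex 0ℙ)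
odd-even-apart path-vertex    branch-vertex  _ = apart! (column path-vertex 1ℙ) (column branch-vertex 0ℙ)
odd-even-apart pendant-vertex path-vertex    _ = apart! (column pendant-vertex 1ℙ) (column path-vertex 0ℙ)
odd-even-apart pendant-vertex pendant-vertex _ = apart! (column pendant-vertex 1ℙ) (column pendant-vertex 0ℙ)
odd-even-apart pendant-vertex branch-vertex  _ = apart! (column pendant-vertex 1ℙ) (column branch-vertex 0ℙ)
odd-even-apart branch-vertex  path-vertex    _ = apart! (column branch-vertex 1ℙ) (column path-vertex 0ℙ)
odd-even-apart branch-vertex  pendant-vertex _ = apart! (column branch-vertex 1ℙ) (column pendant-vertex 0ℙ)
odd-even-apart branch-vertex  branch-vertex  _ = apart! (column branch-vertex 1ℙ) (column branch-vertex 0ℙ)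

columns-apart : ∀ r r′ p → r ≢ path-vertex ⊎ r′ ≢ path-vertex →
  ¬ Intersect (column r (p ⁻¹)) (column r′ p)
columns-apart r r′ 0ℙ not-both = odd-even-apart r r′ not-both
columns-apart r r′ 1ℙ not-both meet =
  odd-even-apart r′ r (swap not-both) (Intersect-sym (column r 0ℙ) (column r′ 1ℙ) meet)

pendant-branch-apart : ∀ p → ¬ Intersect (column pendant-vertex p) (column branch-vertex p)
pendant-branch-apart 0ℙ = apart! (column pendant-vertex 0ℙ) (column branch-vertex 0ℙ)
pendant-branch-apart 1ℙ = apart! (column pendant-vertex 1ℙ) (column branch-vertex 1ℙ)

mod-two : ∀ i → (parity i ≡ 0ℙ × i % 2 ≡ 0) ⊎ (parity i ≡ 1ℙ × i % 2 ≡ 1)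
mod-two 0             = inj₁ (refl , refl)
mod-two 1             = inj₂ (refl , refl)
mod-two (suc (suc i)) = mod-two i

by-parity : ∀ {A : Set} (f : Parity → A) i {a} →
  (i % 2 ≡ 1 → a ≡ f 1ℙ) × (i % 2 ≡ 0 → a ≡ f 0ℙ) → a ≡ f (parity i)
by-parity f i (odd , even) with mod-two i
... | inj₁ (p≡0 , r) rewrite p≡0 = even r
... | inj₂ (p≡1 , r) rewrite p≡1 = odd r

module Classification {n : ℕ} (G : Graph n) {x y k} {P : List (Fin n)}
  (dist : IsDist G x y k) (shortest : IsShortestPath G x y P)
  (dominating : DominatingPair G x y)
  (enum : ℕ → List (Fin n)) (enumerates : ∀ i → Enumerates G P i (enum i)) where

  open Adjacency G
  open DecMembership (FinP._≟_ {n}) using (_∈?_)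

  geodesic : IsGeodesic G x y P
  geodesic = shortest-geodesic G dist shortest

  position-of : ∀ {a} (a∈P : a ∈ P) → At G P (suc (toℕ (index a∈P))) a
  position-of a∈P = index a∈P , refl , sym (lookup-index a∈P)

  dominated : ∀ {w} → w ∉ P → ∃[ j ] InS G P j w
  dominated {w} w∉P with dominating P (proj₁ shortest) w
  ... | inj₁ w∈P = ⊥-elim (w∉P w∈P)
  ... | inj₂ (c , c∈P , wc) = _ , w∉P , c , position-of c∈P , wc

  at? : ∀ i c → Dec (At G P i c)
  at? i c = FinP.any? λ k → (suc (toℕ k) ℕ.≟ i) ×-dec (lookup P k FinP.≟ c)

  inS? : ∀ i w → Dec (InS G P i w)
  inS? i w = ¬? (w ∈? P) ×-dec FinP.any? λ c → at? i c ×-dec adj? w c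

  inSS? : ∀ v → Dec (InSS G P v)
  inSS? v = ¬? (v ∈? P) ×-dec FinP.any? λ w → ¬? (w ∈? P) ×-dec adj? v w

  meets? : ∀ v j → Dec (MeetsS G P v j)
  meets? v j = FinP.any? λ w → adj? v w ×-dec inS? j w

  -- every vertex is of one of three kinds, with an index i:
  -- the path vertex uᵢ, an enumerated vertex v_{i,k+1} of Sᵢ ∖ S, or a vertex of Sᵢ ∩ S
  data Kind (i : ℕ) (v : Fin n) : Set where
    path    : At G P i v → Kind i v
    pendant : (k : Fin (length (enum i))) → lookup (enum i) k ≡ v →
              InS G P i v → ¬ InSS G P v → Kind i v
    branch  : InS G P i v → InSS G P v → Kind i v

  classify : ∀ v → ∃[ i ] Kind i v
  classify v with v ∈? P
  ... | yes v∈P = _ , path (position-of v∈P)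
  ... | no v∉P with dominated v∉P | inSS? v
  ...   | i , S | yes s = i , branch S s
  ...   | i , S | no ¬s = i , pendant (index listed) (sym (lookup-index listed)) S ¬s
    where listed = Equivalence.from (proj₂ (enumerates i) v) (S , ¬s)

  role : ∀ {i v} → Kind i v → Role
  role (path _)          = path-vertex
  role (pendant _ _ _ _) = pendant-vertex
  role (branch _ _)      = branch-vertex

  path-pair? : ∀ {i j u v} (Ku : Kind i u) (Kv : Kind j v) →
    (At G P i u × At G P j v) ⊎ (role Ku ≢ path-vertex ⊎ role Kv ≢ path-vertex)
  path-pair? (path A)          (path B)          = inj₁ (A , B)
  path-pair? (path _)          (pendant _ _ _ _) = inj₂ (inj₂ λ ())
  path-pair? (path _)          (branch _ _)      = inj₂ (inj₂ λ ())
  path-pair? (pendant _ _ _ _) _                 = inj₂ (inj₁ λ ())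
  path-pair? (branch _ _)      _                 = inj₂ (inj₁ λ ())

module Separation {m : ℕ} (G : Graph (suc m)) (girth : Girth≥5 G) (at : ATFree G)
  {x y k} {P : List (Fin (suc m))}
  (dist : IsDist G x y k) (shortest : IsShortestPath G x y P)
  (dominating : DominatingPair G x y)
  (enum : ℕ → List (Fin (suc m))) (enumerates : ∀ i → Enumerates G P i (enum i))
  (g₁ g₂ : Fin (suc m) → Interval) (spec₁ : G1Spec G P enum g₁) (spec₂ : G2Spec G P g₂) where

  open Adjacency G
  open Classification G dist shortest dominating enum enumerates
  open OnGeodesic G geodesic
  open WithGirth girth
  open WithATFree at

  Separated : Fin (suc m) → Fin (suc m) → Set
  Separated u v = ¬ Intersect (g₁ u) (g₁ v) ⊎ ¬ Intersect (g₂ u) (g₂ v)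

  separated-sym : ∀ {u v} → Separated v u → Separated u v
  separated-sym {u} {v} (inj₁ apart₁) = inj₁ (λ meet → apart₁ (Intersect-sym (g₁ u) (g₁ v) meet))
  separated-sym {u} {v} (inj₂ apart₂) = inj₂ (λ meet → apart₂ (Intersect-sym (g₂ u) (g₂ v) meet))

  g₂-column : ∀ {i v} (K : Kind i v) → g₂ v ≡ column (role K) (parity i)
  g₂-column {i} {v} (path A) = by-parity (column path-vertex) i (proj₁ spec₂ i v A)
  g₂-column {i} {v} (pendant _ _ S ¬s) =
    by-parity (column pendant-vertex) i (proj₁ (proj₂ spec₂) i v S ¬s)
  g₂-column {i} {v} (branch S s) =
    by-parity (column branch-vertex) i (proj₂ (proj₂ spec₂) i v S s)

  g₂-apart : ∀ {i j u v} (Ku : Kind i u) (Kv : Kind j v) →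
    ¬ Intersect (column (role Ku) (parity i)) (column (role Kv) (parity j)) →
    ¬ Intersect (g₂ u) (g₂ v)
  g₂-apart Ku Kv = subst₂ (λ a b → ¬ Intersect a b) (sym (g₂-column Ku)) (sym (g₂-column Kv))

  -- consecutive indices have opposite parities
  consecutive-apart : ∀ {i u v} (Ku : Kind i u) (Kv : Kind (suc i) v) →
    role Ku ≢ path-vertex ⊎ role Kv ≢ path-vertex → ¬ Intersect (g₂ u) (g₂ v)
  consecutive-apart {i} Ku Kv not-both = g₂-apart Ku Kv
    (subst (λ p → ¬ Intersect (column (role Ku) p) (column (role Kv) (parity (suc i))))
           (ParityP.suc-homo-⁻¹ i) (columns-apart (role Ku) (role Kv) (parity (suc i)) not-both))

  -- the denominator 2n of g₁ is the successor of 2n∸1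
  2n∸1 : ℕ
  2n∸1 = m + 1 * suc m

  path-window : ∀ {i v} → At G P i v → Window (g₁ v) i 0ℚ 1ℚ
  path-window {i} {v} A = in-window
    (within-widen (ℚP.≤-reflexive (ℚP.+-identityʳ (q i))) (ℚP.≤-reflexive (q-suc i))
                  (within-≡ (proj₁ spec₁ i v A)))

  pendant-window : ∀ {i v} (k : Fin (length (enum i))) → lookup (enum i) k ≡ v →
    Window (g₁ v) i 0ℚ 1ℚ
  pendant-window {i} k refl =
    window-widen (frac-≤ {0} {2 * suc (toℕ k) ∸ 1} 0 2n∸1 z≤n)
                 (frac-≤ {2 * suc (toℕ k)} {1} 2n∸1 0 doubled)
                 (window-≡ (proj₁ (proj₂ spec₁) i k))
    where
    open ℕP.≤-Reasoning
    -- Sᵢ ∖ S has at most n elements, so 2(k+1) ≤ 2n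
    doubled : 2 * suc (toℕ k) * 1 ≤ 1 * (2 * suc m)
    doubled = begin
      2 * suc (toℕ k) * 1   ≡⟨ ℕP.*-identityʳ _ ⟩
      2 * suc (toℕ k)       ≤⟨ ℕP.*-monoʳ-≤ 2 (ℕP.≤-trans (FinP.toℕ<n k)
                                 (unique-length (proj₁ (enumerates i)))) ⟩
      2 * suc m             ≡⟨ sym (ℕP.*-identityˡ _) ⟩
      1 * (2 * suc m)       ∎

  earlier-pendant-apart : ∀ {i} (k k′ : Fin (length (enum i))) → toℕ k < toℕ k′ →
    ¬ Intersect (g₁ (lookup (enum i) k)) (g₁ (lookup (enum i) k′))
  earlier-pendant-apart {i} k k′ k<k′ =
    below-disjoint (within-≡ (proj₁ (proj₂ spec₁) i k)) (within-≡ (proj₁ (proj₂ spec₁) i k′))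
      (ℚP.+-monoʳ-< (q i) (frac-< {2 * suc (toℕ k)} {2 * suc (toℕ k′) ∸ 1} 2n∸1 2n∸1
                                        (ℕP.*-monoˡ-< (suc 2n∸1) gap)))
    where
    gap : 2 * suc (toℕ k) < 2 * suc (toℕ k′) ∸ 1
    gap = subst (suc (2 * suc (toℕ k)) ≤_) (sym (cong (_∸ 1) (ℕP.*-suc 2 (toℕ k′))))
                (s≤s (ℕP.*-monoʳ-≤ 2 k<k′))

  pendants-apart : ∀ {i u v} (k k′ : Fin (length (enum i))) →
    lookup (enum i) k ≡ u → lookup (enum i) k′ ≡ v → u ≢ v → ¬ Intersect (g₁ u) (g₁ v)
  pendants-apart {i} k k′ refl refl u≢v = by-order (ℕP.<-cmp (toℕ k) (toℕ k′))
    where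
    by-order : Tri (toℕ k < toℕ k′) (toℕ k ≡ toℕ k′) (toℕ k′ < toℕ k) →
      ¬ Intersect (g₁ (lookup (enum i) k)) (g₁ (lookup (enum i) k′))
    by-order (tri< k<k′ _ _) = earlier-pendant-apart k k′ k<k′
    by-order (tri≈ _ k≡k′ _) = ⊥-elim (u≢v (cong (lookup (enum i)) (FinP.toℕ-injective k≡k′)))
    by-order (tri> _ _ k′<k) meet = earlier-pendant-apart k′ k k′<k (Intersect-sym (g₁ _) (g₁ _) meet)

  branch-sides : ∀ {i v} → InS G P i v → InSS G P v → MeetsS G P v (i ∸ 2) ⊎ MeetsS G P v (i + 2)
  branch-sides S (_ , w , w∉P , vw) = branch-meets S (proj₂ (dominated w∉P)) vw

  minus-window : ∀ {i v} → InS G P i v → InSS G P v →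
    MeetsS G P v (i ∸ 2) → ¬ MeetsS G P v (i + 2) → Window (g₁ v) i (ℚ.- ½) 0ℚ
  minus-window {i} {v} S s minus ¬plus = in-window
    (within-widen ℚP.≤-refl (ℚP.≤-reflexive (sym (ℚP.+-identityʳ (q i))))
                  (within-≡ (proj₂ (proj₂ (proj₂ (proj₂ spec₁) i v S s)) minus ¬plus)))

  plus-window : ∀ {i v} → InS G P i v → InSS G P v →
    ¬ MeetsS G P v (i ∸ 2) → MeetsS G P v (i + 2) → Window (g₁ v) i 1ℚ (frac 3 2)
  plus-window {i} {v} S s ¬minus plus = in-window
    (within-widen (ℚP.≤-reflexive (sym (q-suc i))) ℚP.≤-refl
                  (within-≡ (proj₁ (proj₂ (proj₂ (proj₂ spec₁) i v S s)) ¬minus plus)))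

  branch-window : ∀ {i v} → InS G P i v → InSS G P v → Window (g₁ v) i (ℚ.- ½) (frac 3 2)
  branch-window {i} {v} S s = by-sides (meets? v (i ∸ 2)) (meets? v (i + 2))
    where
    by-sides : Dec (MeetsS G P v (i ∸ 2)) → Dec (MeetsS G P v (i + 2)) →
      Window (g₁ v) i (ℚ.- ½) (frac 3 2)
    by-sides (yes minus) (yes plus) = window-≡ (proj₁ (proj₂ (proj₂ spec₁) i v S s) minus plus)
    by-sides (yes minus) (no ¬plus) =
      window-widen ℚP.≤-refl (le! 0ℚ (frac 3 2)) (minus-window S s minus ¬plus)
    by-sides (no ¬minus) (yes plus) =
      window-widen (le! (ℚ.- ½) 1ℚ) ℚP.≤-refl (plus-window S s ¬minus plus)
    by-sides (no ¬minus) (no ¬plus) =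
      ⊥-elim ([ ¬minus , ¬plus ]′ (branch-sides S s))

  narrow-or-branch : ∀ {i v} → Kind i v → Window (g₁ v) i 0ℚ 1ℚ ⊎ (InS G P i v × InSS G P v)
  narrow-or-branch (path A)               = inj₁ (path-window A)
  narrow-or-branch (pendant k listed _ _) = inj₁ (pendant-window k listed)
  narrow-or-branch (branch S s)           = inj₂ (S , s)

  wide-window : ∀ {i v} → Kind i v → Window (g₁ v) i (ℚ.- ½) (frac 3 2)
  wide-window K = [ window-widen (le! (ℚ.- ½) 0ℚ) (le! 1ℚ (frac 3 2))
                   , (λ { (S , s) → branch-window S s }) ]′ (narrow-or-branch K)

  -- S_{i-2} can only be met when i ≥ 3
  meets-below : ∀ {i v} → MeetsS G P v (i ∸ 2) → i ≡ 2 + (i ∸ 2)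
  meets-below {0}           (_ , _ , _ , _ , (_ , () , _) , _)
  meets-below {1}           (_ , _ , _ , _ , (_ , () , _) , _)
  meets-below {suc (suc i)} _ = refl

  -- two non-adjacent vertices of Sᵢ ∩ S see opposite sides, so g₁ separates them
  twin-branches-apart : ∀ {i u v} → InS G P i u → InSS G P u → InS G P i v → InSS G P v →
    u ≢ v → ¬ Adj G u v → ¬ Intersect (g₁ u) (g₁ v)
  twin-branches-apart {i} {u} {v} S s T t u≢v ¬uv = by-sides (branch-sides S s) (branch-sides T t)
    where
    common-minus : MeetsS G P u (i ∸ 2) → MeetsS G P v (i ∸ 2) → ⊥
    common-minus minus-u = no-common-side S T u≢v ¬uv (inj₂ (meets-below minus-u)) minus-u
    common-plus : MeetsS G P u (i + 2) → MeetsS G P v (i + 2) → ⊥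
    common-plus = no-common-side S T u≢v ¬uv (inj₁ (ℕP.+-comm i 2))
    by-sides : MeetsS G P u (i ∸ 2) ⊎ MeetsS G P u (i + 2) →
      MeetsS G P v (i ∸ 2) ⊎ MeetsS G P v (i + 2) → ¬ Intersect (g₁ u) (g₁ v)
    by-sides (inj₁ minus-u) (inj₁ minus-v) = ⊥-elim (common-minus minus-u minus-v)
    by-sides (inj₂ plus-u)  (inj₂ plus-v)  = ⊥-elim (common-plus plus-u plus-v)
    by-sides (inj₁ minus-u) (inj₂ plus-v)  =
      window-gap {d = 0} {m = 0}
        (minus-window S s minus-u (λ plus-u → common-plus plus-u plus-v))
        (plus-window T t (common-minus minus-u) plus-v) z≤n (lt! 0ℚ (q 0 ℚ.+ 1ℚ))
    by-sides (inj₂ plus-u)  (inj₁ minus-v) = λ meet →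
      window-gap {d = 0} {m = 0}
        (minus-window T t minus-v (common-plus plus-u))
        (plus-window S s (λ minus-u → common-minus minus-u minus-v) plus-u) z≤n (lt! 0ℚ (q 0 ℚ.+ 1ℚ))
        (Intersect-sym (g₁ u) (g₁ v) meet)

  -- for u ∈ Sᵢ ∩ S and v ∈ S_{i+2} ∩ S non-adjacent, either u sees only S_{i-2}
  -- or v sees only S_{i+4}; either way g₁ separates them
  staggered-branches-apart : ∀ {i u v} → InS G P i u → InSS G P u →
    InS G P (2 + i) v → InSS G P v → u ≢ v → ¬ Adj G u v → ¬ Intersect (g₁ u) (g₁ v)
  staggered-branches-apart {i} {u} {v} S s T t u≢v ¬uv = by-plus-side (meets? u (i + 2))
    where
    by-plus-side : Dec (MeetsS G P u (i + 2)) → ¬ Intersect (g₁ u) (g₁ v)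
    by-plus-side (yes plus-u) =
      window-gap {d = 2} {m = 2} (branch-window S s) (plus-window T t ¬minus-v plus-v)
                 ℕP.≤-refl (lt! (frac 3 2) (q 2 ℚ.+ 1ℚ))
      where
      ¬minus-v : ¬ MeetsS G P v i
      ¬minus-v minus-v =
        no-crossing S (subst (MeetsS G P u) (ℕP.+-comm i 2) plus-u) T minus-v u≢v ¬uv
      plus-v = fromInj₂ (λ minus-v → ⊥-elim (¬minus-v minus-v)) (branch-sides T t)
    by-plus-side (no ¬plus-u) =
      window-gap {d = 2} {m = 2} (minus-window S s minus-u ¬plus-u) (branch-window T t)
                 ℕP.≤-refl (lt! 0ℚ (q 2 ℚ.- ½))
      where
      minus-u = fromInj₁ (λ plus-u → ⊥-elim (¬plus-u plus-u)) (branch-sides S s)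

  -- at equal indices the roles decide: a path vertex is adjacent to Sᵢ, pendant
  -- vertices get disjoint sub-windows, and g₂ separates pendant from branch vertices
  same-index-separated : ∀ {i u v} → Kind i u → Kind i v → u ≢ v → ¬ Adj G u v → Separated u v
  same-index-separated (path A) (path B) u≢v _ = ⊥-elim (u≢v (same-position A B))
  same-index-separated (path A) (pendant _ _ T _) _ ¬uv = ⊥-elim (¬uv (attached A T))
  same-index-separated (path A) (branch T _)      _ ¬uv = ⊥-elim (¬uv (attached A T))
  same-index-separated (pendant _ _ S _) (path B) _ ¬uv = ⊥-elim (¬uv (adj-sym (attached B S)))
  same-index-separated (branch S _)      (path B) _ ¬uv = ⊥-elim (¬uv (adj-sym (attached B S)))
  same-index-separated (pendant k listed-u _ _) (pendant k′ listed-v _ _) u≢v _ =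
    inj₁ (pendants-apart k k′ listed-u listed-v u≢v)
  same-index-separated {i} Ku@(pendant _ _ _ _) Kv@(branch _ _) _ _ =
    inj₂ (g₂-apart Ku Kv (pendant-branch-apart (parity i)))
  same-index-separated {i} Ku@(branch _ _) Kv@(pendant _ _ _ _) _ _ =
    inj₂ (g₂-apart Ku Kv (λ meet → pendant-branch-apart (parity i)
                                     (Intersect-sym (column branch-vertex (parity i)) _ meet)))
  same-index-separated (branch S s) (branch T t) u≢v ¬uv =
    inj₁ (twin-branches-apart S s T t u≢v ¬uv)

  -- non-adjacent u ≢ v at indices i and d + i are separated: by the roles for d = 0,
  -- by g₂ for d = 1, and by the g₁-windows for d ≥ 2
  separate-ahead : ∀ {i u v} d → Kind i u → Kind (d + i) v → u ≢ v → ¬ Adj G u v → Separated u v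
  separate-ahead 0 = same-index-separated
  separate-ahead 1 Ku Kv _ ¬uv =
    [ (λ { (A , B) → ⊥-elim (¬uv (path-step A B)) })
    , (λ not-both → inj₂ (consecutive-apart Ku Kv not-both)) ]′ (path-pair? Ku Kv)
  separate-ahead 2 Ku Kv u≢v ¬uv = inj₁ (by-narrowness (narrow-or-branch Ku) (narrow-or-branch Kv))
    where
    by-narrowness : Window (g₁ _) _ 0ℚ 1ℚ ⊎ (InS G P _ _ × InSS G P _) →
      Window (g₁ _) _ 0ℚ 1ℚ ⊎ (InS G P _ _ × InSS G P _) → ¬ Intersect (g₁ _) (g₁ _)
    by-narrowness (inj₁ narrow-u) _ =
      window-gap {d = 2} {m = 2} narrow-u (wide-window Kv) ℕP.≤-refl (lt! 1ℚ (q 2 ℚ.- ½))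
    by-narrowness (inj₂ _) (inj₁ narrow-v) =
      window-gap {d = 2} {m = 2} (wide-window Ku) narrow-v ℕP.≤-refl (lt! (frac 3 2) (q 2 ℚ.+ 0ℚ))
    by-narrowness (inj₂ (S , s)) (inj₂ (T , t)) = staggered-branches-apart S s T t u≢v ¬uv
  separate-ahead (suc (suc (suc d))) Ku Kv _ _ =
    inj₁ (window-gap {d = 3 + d} {m = 3} (wide-window Ku) (wide-window Kv)
                     (s≤s (s≤s (s≤s z≤n))) (lt! (frac 3 2) (q 3 ℚ.- ½)))

  separate : ∀ {i j u v} → Kind i u → Kind j v → u ≢ v → ¬ Adj G u v → Separated u v
  separate {i} {j} = by-offset (offset i j)
    where
    by-offset : ∀ {i j u v} → Offset i j → Kind i u → Kind j v → u ≢ v → ¬ Adj G u v →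
      Separated u v
    by-offset (ahead d)  Ku Kv u≢v ¬uv = separate-ahead d Ku Kv u≢v ¬uv
    by-offset (behind d) Ku Kv u≢v ¬uv =
      separated-sym (separate-ahead d Kv Ku (λ v≡u → u≢v (sym v≡u)) (¬adj-sym ¬uv))

lemma8 : {n : ℕ} .{{nz : NonZero n}} (G : Graph n)
    → Connected G → ATFree G → Girth≥5 G
    → (x y : Fin n) → DominatingPair G x y
    → (k : ℕ) → IsDist G x y k → IsDiam G k
    → (P : List (Fin n)) → IsShortestPath G x y P
    → (enum : ℕ → List (Fin n)) → (∀ i → Enumerates G P i (enum i))
    → (g₁ g₂ : Fin n → Interval) → G1Spec G P enum g₁ → G2Spec G P g₂
    → ∀ u v → u ≢ v → ¬ Adj G u v
    → ¬ IntAdj g₁ u v ⊎ ¬ IntAdj g₂ u v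
lemma8 {zero} _ _ _ _ _ _ _ _ _ _ _ _ _ _ _ _ _ _ () _ _ _
lemma8 {suc m} G _ at girth _ _ dominating _ dist _ _ shortest enum enumerates g₁ g₂ spec₁ spec₂
       u v u≢v ¬uv =
  Sum.map (λ apart → apart ∘ proj₂) (λ apart → apart ∘ proj₂)
          (separate (proj₂ (classify u)) (proj₂ (classify v)) u≢v ¬uv)
  where
  open Classification G dist shortest dominating enum enumerates using (classify)
  open Separation G girth at dist shortest dominating enum enumerates g₁ g₂ spec₁ spec₂
    using (separate)
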